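{- For each $x\in\{\Box,\Diamond,\blacksquare,\bullet\}$, the canonical model for $\mathbf{L}_x$ satisfies the monotonicity condition for $x$: for all $w,v\in W$ and $X\subseteq W$ with $w\leq v$ and $v\in X$: (for $\Box$) $X\in\mathcal{N}_w\Rightarrow X\in\mathcal{N}_v$; (for $\Diamond$) $-X\notin\mathcal{N}_w\Rightarrow -X\notin\mathcal{N}_v$; (for $\blacksquare$) $-X\in\mathcal{N}_w\Rightarrow -X\in\mathcal{N}_v$; (for $\bullet$) $X\notin\mathcal{N}_w\Rightarrow X\notin\mathcal{N}_v$.
   Context: For $x\in\{\Box,\Diamond,\blacksquare,\bullet\}$, the $x$-language has formulas built from a countable set $PV$ of propositional variables and $\bot$ by $\land,\lor,\rightarrow$ and the unary modal operator $x$; $\lnot\varphi$ abbreviates $\varphi\to\bot$, $\varphi\leftrightarrow\psi$ abbreviates $(\varphi\to\psi)\land(\psi\to\varphi)$. $\mathbf{L}_x$ is the smallest set of formulas containing all instances of the axiom schemes of intuitionistic propositional logic and all instances of $x\varphi\to\varphi$, closed under modus ponens and the rule: from $\varphi\leftrightarrow\psi$ infer $x\varphi\leftrightarrow x\psi$. A prime theory of $\mathbf{L}_x$ is a set $w$ of formulas with $\mathbf{L}_x\subseteq w$, closed under modus ponens, $\bot\notin w$, and $\varphi\lor\psi\in w$ implies $\varphi\in w$ or $\psi\in w$. The canonical model for $\mathbf{L}_x$ is $\langle W,\mathcal{N},\leq,V\rangle$ with $W$ the set of prime theories of $\mathbf{L}_x$, $w\leq v$ iff $w\subseteq v$, $V(q)=\{w:q\in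 w\}$, $\widehat{\varphi}=\{z\in W:\varphi\in z\}$, $-X=W\setminus X$, and: (for $\Box$) $\mathcal{N}_w=\{\widehat{\varphi}:\Box\varphi\in w\}$; (for $\Diamond$) $\mathcal{N}_w=\{W\setminus\widehat{\varphi}:\Diamond\varphi\notin w\}$; (for $\blacksquare$) $\mathcal{N}_w=\{W\setminus\widehat{\varphi}:\blacksquare\varphi\in w\}$; (for $\bullet$) $\mathcal{N}_w=\{\widehat{\varphi}:\bullet\varphi\notin w\}$. -}

module Defs where

open import Level using (Level) renaming (suc to lsuc; zero to lzero)
open import Data.Nat using (ℕ)
open import Data.Product using (Σ; _×_; _,_)
open import Data.Sum using (_⊎_)
open import Data.Empty using (⊥)
open import Relation.Nullary using (¬_)

data Op : Set where
  box dia bbox bullet : Op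

-- Formulas of the x-language: PV = ℕ, ⊥, ∧, ∨, →, and one unary modal operator.
-- (The syntax is the same for every x; only the intended reading differs.)
infixr 20 _⇒_
infixr 30 _∨'_
infixr 40 _∧'_
data Fm : Set where
  var  : ℕ → Fm
  ⊥'   : Fm
  _∧'_ : Fm → Fm → Fm
  _∨'_ : Fm → Fm → Fm
  _⇒_  : Fm → Fm → Fm
  mod  : Fm → Fm

_⇔_ : Fm → Fm → Fm
φ ⇔ ψ = (φ ⇒ ψ) ∧' (ψ ⇒ φ)

data L (x : Op) : Fm → Set where
  ax-K   : ∀ φ ψ → L x (φ ⇒ (ψ ⇒ φ))
  ax-S   : ∀ φ ψ χ → L x ((φ ⇒ (ψ ⇒ χ)) ⇒ ((φ ⇒ ψ) ⇒ (φ ⇒ χ)))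
  ax-∧I  : ∀ φ ψ → L x (φ ⇒ (ψ ⇒ (φ ∧' ψ)))
  ax-∧E₁ : ∀ φ ψ → L x ((φ ∧' ψ) ⇒ φ)
  ax-∧E₂ : ∀ φ ψ → L x ((φ ∧' ψ) ⇒ ψ)
  ax-∨I₁ : ∀ φ ψ → L x (φ ⇒ (φ ∨' ψ))
  ax-∨I₂ : ∀ φ ψ → L x (ψ ⇒ (φ ∨' ψ))
  ax-∨E  : ∀ φ ψ χ → L x ((φ ⇒ χ) ⇒ ((ψ ⇒ χ) ⇒ ((φ ∨' ψ) ⇒ χ)))
  ax-EFQ : ∀ φ → L x (⊥' ⇒ φ)
  ax-T   : ∀ φ → L x (mod φ ⇒ φ)
  mp     : ∀ {φ ψ} → L x (φ ⇒ ψ) → L x φ → L x ψ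
  cong-x : ∀ {φ ψ} → L x (φ ⇔ ψ) → L x (mod φ ⇔ mod ψ)

record PrimeTheory (x : Op) : Set₁ where
  field
    mem      : Fm → Set
    has-L    : ∀ {φ} → L x φ → mem φ
    mp-closed : ∀ {φ ψ} → mem (φ ⇒ ψ) → mem φ → mem ψ
    no-⊥     : ¬ mem ⊥'
    prime    : ∀ {φ ψ} → mem (φ ∨' ψ) → mem φ ⊎ mem ψ
open PrimeTheory public

W : Op → Set₁
W x = PrimeTheory x

_≤_ : ∀ {x} → W x → W x → Set
w ≤ v = ∀ φ → mem w φ → mem v φ

Subset : Op → Set₁
Subset x = W x → Set

_≐_ : ∀ {x} → Subset x → Subset x → Set₁
X ≐ Y = ∀ z → (X z → Y z) × (Y z → X z)

-_ : ∀ {x} → Subset x → Subset x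
(- X) z = ¬ X z

hat : ∀ {x} → Fm → Subset x
hat φ z = mem z φ

N : (x : Op) → W x → Subset x → Set₁
N box    w X = Σ Fm λ φ → mem w (mod φ) × (X ≐ hat φ)
N dia    w X = Σ Fm λ φ → ¬ mem w (mod φ) × (X ≐ (- hat φ))
N bbox   w X = Σ Fm λ φ → mem w (mod φ) × (X ≐ (- hat φ))
N bullet w X = Σ Fm λ φ → ¬ mem w (mod φ) × (X ≐ hat φ)

MonCond : (x : Op) → W x → W x → Subset x → Set₁
MonCond box    w v X = N box w X → N box v X
MonCond dia    w v X = ¬ N dia w (- X) → ¬ N dia v (- X)
MonCond bbox   w v X = N bbox w (- X) → N bbox v (- X)
MonCond bullet w v X = ¬ N bullet w X → ¬ N bullet v X

{-# OPTIONS --safe #-}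
module Submission where

open import Defs
open import Data.Product using (_,_)
open import Relation.Nullary.Negation using (contraposition)

-- For □ and ■ a neighbourhood of w is witnessed by a formula mod φ ∈ w, and membership
-- persists along ⊆; for ◇ and • it is witnessed by mod φ ∉ w, and non-membership persists
-- backwards along ⊆. So N_w ⊆ N_v for □, ■ and N_v ⊆ N_w for ◇, •, which contraposes to
-- the stated conditions.

N-box-upward : (w v : W box) {Y : Subset box} → w ≤ v → N box w Y → N box v Y
N-box-upward w v w≤v (φ , □φ∈w , Y≐φ̂) = φ , w≤v (mod φ) □φ∈w , Y≐φ̂

N-bbox-upward : (w v : W bbox) {Y : Subset bbox} → w ≤ v → N bbox w Y → N bbox v Y
N-bbox-upward w v w≤v (φ , ■φ∈w , Y≐-φ̂) = φ , w≤v (mod φ) ■φ∈w , Y≐-φ̂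

N-dia-downward : (w v : W dia) {Y : Subset dia} → w ≤ v → N dia v Y → N dia w Y
N-dia-downward w v w≤v (φ , ◇φ∉v , Y≐-φ̂) = φ , contraposition (w≤v (mod φ)) ◇φ∉v , Y≐-φ̂

N-bullet-downward : (w v : W bullet) {Y : Subset bullet} → w ≤ v → N bullet v Y → N bullet w Y
N-bullet-downward w v w≤v (φ , •φ∉v , Y≐φ̂) = φ , contraposition (w≤v (mod φ)) •φ∉v , Y≐φ̂

mainTheorem14 : (x : Op) → (w v : W x) → (X : Subset x) →
    w ≤ v → X v → MonCond x w v X
mainTheorem14 box    w v X w≤v _ = N-box-upward w v w≤v
mainTheorem14 bbox   w v X w≤v _ = N-bbox-upward w v w≤v
mainTheorem14 dia    w v X w≤v _ = contraposition (N-dia-downward w v w≤v)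
mainTheorem14 bullet w v X w≤v _ = contraposition (N-bullet-downward w v w≤v)
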